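{- Let $b\ge2$ be an integer and let $n>0$ have base-$b$ digits $n=(n_{N-1}\cdots n_s0\cdots0)_b$, i.e. $n_0=\dots=n_{s-1}=0$ and $n_s\ne0$, for some $s\ge1$. Then for every $m\in\{0,\dots,s-1\}$ and every integer $k$ with $k\ge b^s$ or $k\le -n+b^m$, \[ \binom{ -n+b^s}{k}_b=\sum_{\substack{0\le j\le b^s\\ b^m\mid j}}\binom{b^s-b^m}{j}_b\binom{ -n+b^m}{k-j}_b . \]
   Context: Fix an integer base $b\ge2$. Every integer $r\ge0$ has base-$b$ digits $r_l\in\{0,\dots,b-1\}$ with $r=\sum_{l\ge0}r_lb^l$. By convention, for $r>0$ the digits of $-r$ are $-r_l$. For $r\in\mathbb Z$ with digits $r_l$, put $f_{r,b}(x)=\prod_{l\ge0}(1+x^{b^l})^{r_l}$. The $b$-ary binomial coefficient $\binom{r}{k}_b$ ($r,k\in\mathbb Z$) is defined as: if $r\ge0$, the coefficient of $x^k$ in the polynomial $f_{r,b}(x)$ (zero for $k<0$); if $r<0$ and $k\ge0$, the coefficient of $x^k$ in the power series expansion of $f_{r,b}(x)$ about $x=0$; if $r<0$ and $k<0$, the coefficient of $x^k$ in the expansion of $f_{r,b}(x)$ as a power series in $1/x$. -}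

module Defs where

open import Data.Nat as ℕ using (ℕ; zero; suc; NonZero)
open import Data.Nat.Properties using (m^n≢0)
open import Data.Nat.DivMod using (_/_; _%_)
open import Data.Nat.Divisibility using (_∣?_)
open import Data.Integer as ℤ using (ℤ; +_; -[1+_]; _+_; _*_; -_)
open import Data.Bool using (Bool; true; false; if_then_else_)
open import Relation.Nullary.Decidable using (⌊_⌋)

digit : (b : ℕ) → .{{_ : NonZero b}} → ℕ → ℕ → ℕ
digit b r l = (r / (b ℕ.^ l)) {{m^n≢0 b l}} % b

sumTo : ℕ → (ℕ → ℤ) → ℤ
sumTo zero    f = f 0
sumTo (suc n) f = sumTo n f + f (suc n)

Series : Set
Series = ℕ → ℤ

oneS : Series
oneS zero    = + 1
oneS (suc _) = + 0

_⊛_ : Series → Series → Series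
(f ⊛ g) n = sumTo n (λ i → f i * g (n ℕ.∸ i))

powS : Series → ℕ → Series
powS f zero    = oneS
powS f (suc e) = f ⊛ powS f e

prodS : ℕ → (ℕ → Series) → (ℕ → ℕ) → Series
prodS zero    F e = oneS
prodS (suc L) F e = prodS L F e ⊛ powS (F L) (e L)

ind : Bool → ℤ → ℤ
ind c z = if c then z else + 0

sign : ℕ → ℤ
sign zero    = + 1
sign (suc t) = - sign t

onePlusX : ℕ → Series
onePlusX d i = ind ⌊ i ℕ.≟ 0 ⌋ (+ 1) + ind ⌊ i ℕ.≟ d ⌋ (+ 1)

-- (1 + x^d)^(-1) expanded as a power series in x about 0 (d ≥ 1):
--   Σ_{t ≥ 0} (-1)^t x^{d t}
invInX : (d : ℕ) → .{{_ : NonZero d}} → Series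
invInX d i = ind ⌊ d ∣? i ⌋ (sign (i / d))

-- (1 + x^d)^(-1) expanded as a power series in y = 1/x (d ≥ 1):
--   (1 + y^{-d})^{-1} = y^d (1 + y^d)^{-1} = Σ_{t ≥ 0} (-1)^t y^{d (t+1)}
invInY : (d : ℕ) → .{{_ : NonZero d}} → Series
invInY d zero    = + 0
invInY d (suc i) = ind ⌊ d ∣? suc i ⌋ (sign ((suc i / d) ℕ.∸ 1))

-- f_{r,b} for r = R ≥ 0, as a polynomial in x:  ∏_l (1 + x^{b^l})^{R_l}
-- (digits R_l vanish for l ≥ R+1 since b^l > l, so the product is finite)
fPos : (b : ℕ) → .{{_ : NonZero b}} → ℕ → Series
fPos b R = prodS (suc R) (λ l → onePlusX (b ℕ.^ l)) (digit b R)

-- f_{-R,b} (R > 0) expanded about x = 0:  ∏_l ((1 + x^{b^l})^{-1})^{R_l}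
fNegX : (b : ℕ) → .{{_ : NonZero b}} → ℕ → Series
fNegX b R = prodS (suc R) (λ l → invInX (b ℕ.^ l) {{m^n≢0 b l}}) (digit b R)

-- f_{-R,b} (R > 0) expanded as a power series in y = 1/x
fNegY : (b : ℕ) → .{{_ : NonZero b}} → ℕ → Series
fNegY b R = prodS (suc R) (λ l → invInY (b ℕ.^ l) {{m^n≢0 b l}}) (digit b R)

bbinom : (b : ℕ) → .{{_ : NonZero b}} → ℤ → ℤ → ℤ
bbinom b (+ R)       (+ k)       = fPos b R k
bbinom b (+ R)       -[1+ k ]    = + 0
bbinom b -[1+ R ]    (+ k)       = fNegX b (suc R) k
-- coefficient of x^{-(k+1)} = coefficient of y^{k+1}
bbinom b -[1+ R ]    -[1+ k ]    = fNegY b (suc R) (suc k)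

module Submission where

-- Write n = bˢ + A with bˢ ∣ A, and put
-- C = bˢ − bᵐ.  Then −n + bˢ = −A, −n + bᵐ = −(A + C) and bˢ − bᵐ = C, and since C < bˢ the
-- base-b digits of A + C are those of A plus those of C.  Hence f_{−(A+C)} is f_{−A} times the
-- inverses of the factors of f_C, i.e.  f_C · f_{−(A+C)} = f_{−A}  as power series in x.
-- For k ≥ bˢ ≥ C, comparing coefficients of x^k in this identity is the claim.  For
-- k ≤ −(A+C) the coefficients are read from the expansions in 1/x, which are the expansions
-- in x shifted by A resp. A + C; the symmetry x^C f_C(1/x) = f_C(x) turns the same identity
-- into the claim.  In both ranges the condition bᵐ ∣ j is harmless: the digits of C below m
-- vanish, so f_C involves only powers x^j with bᵐ ∣ j.

open import Defs
open import Algebra.Bundles using (CommutativeMonoid)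
open import Data.Empty using (⊥-elim)
open import Function using (_∘_)
open import Data.Integer as ℤ using (ℤ; +_; -[1+_]; _+_; _*_; _-_; -_; +0; +≤+; -≤-)
import Data.Integer.Properties as ℤP
open import Data.Integer.Tactic.RingSolver using (solve-∀)
import Data.Nat.Tactic.RingSolver as ℕSolver
open import Data.Nat as ℕ using (ℕ; zero; suc; NonZero; _^_; z≤n; s≤s)
import Data.Nat.Properties as ℕP
open import Data.Nat.Divisibility
  using (_∣_; _∣?_; _∣0; ∣-refl; ∣⇒≤; n∣m*n; ∣n⇒∣m*n; m∣m*n; ∣m+n∣m⇒∣n; ∣m∸n∣n⇒∣m)
open import Data.Nat.DivMod
  using (_/_; _%_; 0/n≡0; n/1≡n; m*n/n≡m; m<n⇒m/n≡0; m<n⇒m%n≡m; m≡m%n+[m/n]*n; /-congʳ; m/n/o≡m/[n*o];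
         +-distrib-/-∣ˡ; %-remove-+ˡ; m/n≡1+[m∸n]/n; [m∸n]/n≡m/n∸1)
open import Data.Product using (_,_; ∃)
open import Data.Sum using (_⊎_; inj₁; inj₂; map₂)
open import Level using (0ℓ)
open import Relation.Binary.PropositionalEquality hiding (J)
import Relation.Binary.Reasoning.Setoid
open import Relation.Nullary using (¬_; Dec)
open import Relation.Nullary.Decidable using (⌊_⌋; yes; no)

sum-cong≤ : ∀ N {f g : ℕ → ℤ} → (∀ i → i ℕ.≤ N → f i ≡ g i) → sumTo N f ≡ sumTo N g
sum-cong≤ zero    f≡g = f≡g 0 z≤n
sum-cong≤ (suc N) f≡g =
  cong₂ _+_ (sum-cong≤ N (λ i i≤N → f≡g i (ℕP.m≤n⇒m≤1+n i≤N))) (f≡g (suc N) ℕP.≤-refl)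

sum-cong : ∀ N {f g : ℕ → ℤ} → f ≗ g → sumTo N f ≡ sumTo N g
sum-cong N f≗g = sum-cong≤ N (λ i _ → f≗g i)

sum-zero : ∀ N {f : ℕ → ℤ} → (∀ i → i ℕ.≤ N → f i ≡ +0) → sumTo N f ≡ +0
sum-zero N {f} f≡0 = trans (sum-cong≤ N f≡0) (zeros N)
  where
  zeros : ∀ N → sumTo N (λ _ → +0) ≡ +0
  zeros zero    = refl
  zeros (suc N) = cong (_+ +0) (zeros N)

sum-+ : ∀ N (f g : ℕ → ℤ) → sumTo N (λ i → f i + g i) ≡ sumTo N f + sumTo N g
sum-+ zero    f g = refl
sum-+ (suc N) f g = trans (cong (_+ (f (suc N) + g (suc N))) (sum-+ N f g))
                          (interchange (sumTo N f) (sumTo N g) (f (suc N)) (g (suc N)))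
  where
  interchange : ∀ a b c d → (a + b) + (c + d) ≡ (a + c) + (b + d)
  interchange = solve-∀

sum-*ˡ : ∀ N c (f : ℕ → ℤ) → c * sumTo N f ≡ sumTo N (λ i → c * f i)
sum-*ˡ zero    c f = refl
sum-*ˡ (suc N) c f = trans (ℤP.*-distribˡ-+ c (sumTo N f) (f (suc N)))
                           (cong (_+ c * f (suc N)) (sum-*ˡ N c f))

sum-shrink : ∀ M N {f : ℕ → ℤ} → M ℕ.≤ N → (∀ i → M ℕ.< i → i ℕ.≤ N → f i ≡ +0) →
             sumTo N f ≡ sumTo M f
sum-shrink M zero    z≤n  _   = refl
sum-shrink M (suc N) M≤1+N f≡0 with M ℕ.≟ suc N
... | yes refl = refl
... | no  M≢   = trans (cong₂ _+_ (sum-shrink M N M≤N (λ i M<i i≤N → f≡0 i M<i (ℕP.m≤n⇒m≤1+n i≤N)))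
                                  (f≡0 (suc N) M<1+N ℕP.≤-refl))
                       (ℤP.+-identityʳ _)
  where
  M<1+N = ℕP.≤∧≢⇒< M≤1+N M≢
  M≤N   = ℕP.≤-pred M<1+N

sum-swap : ∀ N M (F : ℕ → ℕ → ℤ) →
           sumTo N (λ a → sumTo M (F a)) ≡ sumTo M (λ c → sumTo N (λ a → F a c))
sum-swap zero    M F = refl
sum-swap (suc N) M F = trans (cong (_+ sumTo M (F (suc N))) (sum-swap N M F))
                             (sym (sum-+ M (λ c → sumTo N (λ a → F a c)) (F (suc N))))

sum-uncons : ∀ N (f : ℕ → ℤ) → sumTo (suc N) f ≡ f 0 + sumTo N (λ i → f (suc i))
sum-uncons zero    f = refl
sum-uncons (suc N) f = trans (cong (_+ f (suc (suc N))) (sum-uncons N f))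
                             (ℤP.+-assoc (f 0) (sumTo N (λ i → f (suc i))) (f (suc (suc N))))

sum-reverse : ∀ N (f : ℕ → ℤ) → sumTo N f ≡ sumTo N (λ j → f (N ℕ.∸ j))
sum-reverse zero    f = refl
sum-reverse (suc N) f = begin
  sumTo N f + f (suc N)                          ≡⟨ cong (_+ f (suc N)) (sum-reverse N f) ⟩
  sumTo N (λ j → f (N ℕ.∸ j)) + f (suc N)        ≡⟨ ℤP.+-comm _ (f (suc N)) ⟩
  f (suc N) + sumTo N (λ j → f (N ℕ.∸ j))        ≡⟨ sum-uncons N (λ j → f (suc N ℕ.∸ j)) ⟨
  sumTo (suc N) (λ j → f (suc N ℕ.∸ j))          ∎
  where open ≡-Reasoning

ind-yes : ∀ {P : Set} (P? : Dec P) z → P → ind ⌊ P? ⌋ z ≡ z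
ind-yes (yes _)  z _ = refl
ind-yes (no  ¬p) z p = ⊥-elim (¬p p)

ind-no : ∀ {P : Set} (P? : Dec P) z → ¬ P → ind ⌊ P? ⌋ z ≡ +0
ind-no (yes p) z ¬p = ⊥-elim (¬p p)
ind-no (no  _) z _  = refl

ind-cong : ∀ {P Q : Set} (P? : Dec P) (Q? : Dec Q) {z z′} →
           (P → Q) → (Q → P) → (P → z ≡ z′) → ind ⌊ P? ⌋ z ≡ ind ⌊ Q? ⌋ z′
ind-cong (yes p)  (yes _)  to from z≡z′ = z≡z′ p
ind-cong (no  _)  (no  _)  to from z≡z′ = refl
ind-cong (yes p)  (no  ¬q) to from z≡z′ = ⊥-elim (¬q (to p))
ind-cong (no  ¬p) (yes q)  to from z≡z′ = ⊥-elim (¬p (from q))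

ind-natural : ∀ (φ : ℤ → ℤ) → φ +0 ≡ +0 → ∀ {P : Set} (P? : Dec P) z → φ (ind ⌊ P? ⌋ z) ≡ ind ⌊ P? ⌋ (φ z)
ind-natural φ φ0 (yes _) z = refl
ind-natural φ φ0 (no  _) z = φ0

δ : ℕ → ℕ → ℤ → ℤ
δ i m z = ind ⌊ i ℕ.≟ m ⌋ z

δ-same : ∀ m z → δ m m z ≡ z
δ-same m z = ind-yes (m ℕ.≟ m) z refl

δ-other : ∀ {i m} z → i ≢ m → δ i m z ≡ +0
δ-other {i} {m} z = ind-no (i ℕ.≟ m) z

δ-cong : ∀ {i j m n} z → (i ≡ m → j ≡ n) → (j ≡ n → i ≡ m) → δ i m z ≡ δ j n z
δ-cong {i} {j} {m} {n} z to from = ind-cong (i ℕ.≟ m) (j ℕ.≟ n) to from (λ _ → refl)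

δ-sym : ∀ i m z → δ i m z ≡ δ m i z
δ-sym i m z = δ-cong {i} {m} {m} {i} z sym sym

δ-natural : ∀ (φ : ℤ → ℤ) → φ +0 ≡ +0 → ∀ i m z → φ (δ i m z) ≡ δ i m (φ z)
δ-natural φ φ0 i m = ind-natural φ φ0 (i ℕ.≟ m)

δ-comm : ∀ i m j n z → δ i m (δ j n z) ≡ δ j n (δ i m z)
δ-comm i m j n z = sym (δ-natural (δ j n) (sym (δ-natural (λ _ → +0) refl j n +0)) i m z)

δ-sum : ∀ i m N (F : ℕ → ℤ) → δ i m (sumTo N F) ≡ sumTo N (λ x → δ i m (F x))
δ-sum i m N F with i ℕ.≟ m
... | yes _ = refl
... | no  _ = sym (sum-zero N (λ _ _ → refl))

sum-δ-out : ∀ N m (F : ℕ → ℤ) → N ℕ.< m → sumTo N (λ a → δ a m (F a)) ≡ +0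
sum-δ-out N m F N<m = sum-zero N (λ a a≤N → δ-other (F a) (λ { refl → ℕP.<⇒≱ N<m a≤N }))

sum-δ : ∀ N m (F : ℕ → ℤ) → m ℕ.≤ N → sumTo N (λ a → δ a m (F a)) ≡ F m
sum-δ zero    .zero F z≤n = δ-same 0 (F 0)
sum-δ (suc N) m     F m≤1+N with m ℕ.≟ suc N
... | yes refl = trans (cong₂ _+_ (sum-δ-out N (suc N) F ℕP.≤-refl) (δ-same (suc N) (F (suc N))))
                       (ℤP.+-identityˡ _)
... | no  m≢   = trans (cong₂ _+_ (sum-δ N m F (ℕP.≤-pred (ℕP.≤∧≢⇒< m≤1+N m≢)))
                                  (δ-other (F (suc N)) (m≢ ∘ sym)))
                       (ℤP.+-identityʳ _)


-- The Cauchy product.  A convolution coefficient is a double sum with a selector on the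
-- total degree; this form makes reindexing arguments (associativity, palindromes) routine.

⊛-row : ∀ N₂ n a (f g : Series) → (∀ c → N₂ ℕ.< c → c ℕ.≤ n → g c ≡ +0) → a ℕ.≤ n →
        sumTo N₂ (λ c → δ (a ℕ.+ c) n (f a * g c)) ≡ f a * g (n ℕ.∸ a)
⊛-row N₂ n a f g g≡0 a≤n = trans (sum-cong N₂ (λ c → δ-cong (f a * g c) to from)) pick
  where
  to : ∀ {c} → a ℕ.+ c ≡ n → c ≡ n ℕ.∸ a
  to {c} a+c≡n = trans (sym (ℕP.m+n∸m≡n a c)) (cong (ℕ._∸ a) a+c≡n)
  from : ∀ {c} → c ≡ n ℕ.∸ a → a ℕ.+ c ≡ n
  from c≡n∸a = trans (cong (a ℕ.+_) c≡n∸a) (ℕP.m+[n∸m]≡n a≤n)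
  pick : sumTo N₂ (λ c → δ c (n ℕ.∸ a) (f a * g c)) ≡ f a * g (n ℕ.∸ a)
  pick with (n ℕ.∸ a) ℕ.≤? N₂
  ... | yes inside = sum-δ N₂ (n ℕ.∸ a) (λ c → f a * g c) inside
  ... | no  beyond = trans (sum-δ-out N₂ (n ℕ.∸ a) (λ c → f a * g c) (ℕP.≰⇒> beyond))
                           (sym (trans (cong (f a *_) (g≡0 (n ℕ.∸ a) (ℕP.≰⇒> beyond) (ℕP.m∸n≤m n a)))
                                       (ℤP.*-zeroʳ (f a))))

⊛-row-beyond : ∀ N₂ n a (F : ℕ → ℤ) → n ℕ.< a → sumTo N₂ (λ c → δ (a ℕ.+ c) n (F c)) ≡ +0
⊛-row-beyond N₂ n a F n<a =
  sum-zero N₂ (λ c _ → δ-other (F c) (λ a+c≡n → ℕP.<⇒≱ n<a (subst (a ℕ.≤_) a+c≡n (ℕP.m≤m+n a c))))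

⊛-as-rectangle : ∀ N₁ N₂ n (f g : Series) →
  (∀ a → N₁ ℕ.< a → a ℕ.≤ n → f a ≡ +0) → (∀ c → N₂ ℕ.< c → c ℕ.≤ n → g c ≡ +0) →
  (f ⊛ g) n ≡ sumTo N₁ (λ a → sumTo N₂ (λ c → δ (a ℕ.+ c) n (f a * g c)))
⊛-as-rectangle N₁ N₂ n f g f≡0 g≡0 with ℕP.≤-total N₁ n
... | inj₁ N₁≤n = sym (begin
  sumTo N₁ (λ a → sumTo N₂ (λ c → δ (a ℕ.+ c) n (f a * g c)))
    ≡⟨ sum-cong≤ N₁ (λ a a≤N₁ → ⊛-row N₂ n a f g g≡0 (ℕP.≤-trans a≤N₁ N₁≤n)) ⟩
  sumTo N₁ (λ a → f a * g (n ℕ.∸ a))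
    ≡⟨ sum-shrink N₁ n N₁≤n (λ a N₁<a a≤n → trans (cong (_* g (n ℕ.∸ a)) (f≡0 a N₁<a a≤n))
                                                  (ℤP.*-zeroˡ (g (n ℕ.∸ a)))) ⟨
  (f ⊛ g) n ∎)
  where open ≡-Reasoning
... | inj₂ n≤N₁ = sym (begin
  sumTo N₁ (λ a → sumTo N₂ (λ c → δ (a ℕ.+ c) n (f a * g c)))
    ≡⟨ sum-shrink n N₁ n≤N₁ (λ a n<a _ → ⊛-row-beyond N₂ n a (λ c → f a * g c) n<a) ⟩
  sumTo n (λ a → sumTo N₂ (λ c → δ (a ℕ.+ c) n (f a * g c)))
    ≡⟨ sum-cong≤ n (λ a a≤n → ⊛-row N₂ n a f g g≡0 a≤n) ⟩
  (f ⊛ g) n ∎)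
  where open ≡-Reasoning

⊛-as-square : ∀ n a → a ℕ.≤ n → (f g : Series) →
              (f ⊛ g) a ≡ sumTo n (λ x → sumTo n (λ y → δ (x ℕ.+ y) a (f x * g y)))
⊛-as-square n a a≤n f g = ⊛-as-rectangle n n a f g outside outside
  where
  outside : ∀ {h : Series} x → n ℕ.< x → x ℕ.≤ a → h x ≡ +0
  outside x n<x x≤a = ⊥-elim (ℕP.<⇒≱ n<x (ℕP.≤-trans x≤a a≤n))

⊛-cong : ∀ {f f′ g g′} → f ≗ f′ → g ≗ g′ → f ⊛ g ≗ f′ ⊛ g′
⊛-cong f≗f′ g≗g′ n = sum-cong n (λ i → cong₂ _*_ (f≗f′ i) (g≗g′ (n ℕ.∸ i)))

⊛-congˡ : ∀ {f f′} g → f ≗ f′ → f ⊛ g ≗ f′ ⊛ g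
⊛-congˡ {f} {f′} g f≗f′ = ⊛-cong {f} {f′} {g} {g} f≗f′ (λ _ → refl)

⊛-congʳ : ∀ f {g g′} → g ≗ g′ → f ⊛ g ≗ f ⊛ g′
⊛-congʳ f {g} {g′} g≗g′ = ⊛-cong {f} {f} {g} {g′} (λ _ → refl) g≗g′

⊛-comm : ∀ f g → f ⊛ g ≗ g ⊛ f
⊛-comm f g n = begin
  sumTo n (λ i → f i * g (n ℕ.∸ i))                   ≡⟨ sum-reverse n _ ⟩
  sumTo n (λ j → f (n ℕ.∸ j) * g (n ℕ.∸ (n ℕ.∸ j)))   ≡⟨ sum-cong≤ n swap ⟩
  sumTo n (λ j → g j * f (n ℕ.∸ j))                   ∎
  where
  open ≡-Reasoning
  swap : ∀ j → j ℕ.≤ n → f (n ℕ.∸ j) * g (n ℕ.∸ (n ℕ.∸ j)) ≡ g j * f (n ℕ.∸ j)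
  swap j j≤n = trans (cong (λ i → f (n ℕ.∸ j) * g i) (ℕP.m∸[m∸n]≡n j≤n)) (ℤP.*-comm (f (n ℕ.∸ j)) (g j))

cube : Series → Series → Series → ℕ → ℤ
cube f g h n = sumTo n λ x → sumTo n λ y → sumTo n λ z → δ (x ℕ.+ (y ℕ.+ z)) n (f x * (g y * h z))

sum-δ-nested : ∀ n (L : ℕ → ℕ) → (∀ c → c ℕ.≤ L c) → ∀ w z →
               sumTo n (λ c → δ (L c) n (δ w c z)) ≡ δ (L w) n z
sum-δ-nested n L c≤Lc w z = trans (sum-cong n (λ c → δ-comm (L c) n w c z)) (trans flip pick)
  where
  flip : sumTo n (λ c → δ w c (δ (L c) n z)) ≡ sumTo n (λ c → δ c w (δ (L c) n z))
  flip = sum-cong n (λ c → δ-sym w c (δ (L c) n z))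
  pick : sumTo n (λ c → δ c w (δ (L c) n z)) ≡ δ (L w) n z
  pick with w ℕ.≤? n
  ... | yes w≤n = sum-δ n w (λ c → δ (L c) n z) w≤n
  ... | no  w≰n = trans (sum-δ-out n w _ (ℕP.≰⇒> w≰n))
                        (sym (δ-other z (λ Lw≡n → w≰n (subst (w ℕ.≤_) Lw≡n (c≤Lc w)))))

⊛-as-cube : ∀ f g h n → (f ⊛ (g ⊛ h)) n ≡ cube f g h n
⊛-as-cube f g h n = begin
  (f ⊛ (g ⊛ h)) n
    ≡⟨ ⊛-as-square n n ℕP.≤-refl f (g ⊛ h) ⟩
  sumTo n (λ x → sumTo n (λ c → δ (x ℕ.+ c) n (f x * (g ⊛ h) c)))
    ≡⟨ sum-cong n (λ x → sum-cong≤ n (λ c c≤n → expand x c c≤n)) ⟩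
  sumTo n (λ x → sumTo n (λ c → sumTo n (λ y → sumTo n (λ z → term x y z c))))
    ≡⟨ sum-cong n (λ x → trans (sum-swap n n _) (sum-cong n (λ y → sum-swap n n _))) ⟩
  sumTo n (λ x → sumTo n (λ y → sumTo n (λ z → sumTo n (λ c → term x y z c))))
    ≡⟨ sum-cong n (λ x → sum-cong n (λ y → sum-cong n (λ z →
         sum-δ-nested n (x ℕ.+_) (λ c → ℕP.m≤n+m c x) (y ℕ.+ z) _))) ⟩
  cube f g h n ∎
  where
  open ≡-Reasoning
  term : ℕ → ℕ → ℕ → ℕ → ℤ
  term x y z c = δ (x ℕ.+ c) n (δ (y ℕ.+ z) c (f x * (g y * h z)))
  expand : ∀ x c → c ℕ.≤ n →
           δ (x ℕ.+ c) n (f x * (g ⊛ h) c) ≡ sumTo n (λ y → sumTo n (λ z → term x y z c))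
  expand x c c≤n = begin
    δ (x ℕ.+ c) n (f x * (g ⊛ h) c)
      ≡⟨ cong (λ s → δ (x ℕ.+ c) n (f x * s)) (⊛-as-square n c c≤n g h) ⟩
    δ (x ℕ.+ c) n (f x * sumTo n (λ y → sumTo n (λ z → δ (y ℕ.+ z) c (g y * h z))))
      ≡⟨ cong (δ (x ℕ.+ c) n) (trans (sum-*ˡ n (f x) _) (sum-cong n (λ y → trans (sum-*ˡ n (f x) _)
           (sum-cong n (λ z → δ-natural (f x *_) (ℤP.*-zeroʳ (f x)) (y ℕ.+ z) c (g y * h z)))))) ⟩
    δ (x ℕ.+ c) n (sumTo n (λ y → sumTo n (λ z → δ (y ℕ.+ z) c (f x * (g y * h z)))))
      ≡⟨ trans (δ-sum (x ℕ.+ c) n n _) (sum-cong n (λ y → δ-sum (x ℕ.+ c) n n _)) ⟩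
    sumTo n (λ y → sumTo n (λ z → term x y z c)) ∎

cube-rotate : ∀ f g h n → cube h f g n ≡ cube f g h n
cube-rotate f g h n = begin
  cube h f g n
    ≡⟨ sum-swap n n _ ⟩
  sumTo n (λ x → sumTo n (λ z → sumTo n (λ y → δ (z ℕ.+ (x ℕ.+ y)) n (h z * (f x * g y)))))
    ≡⟨ sum-cong n (λ x → sum-swap n n _) ⟩
  sumTo n (λ x → sumTo n (λ y → sumTo n (λ z → δ (z ℕ.+ (x ℕ.+ y)) n (h z * (f x * g y)))))
    ≡⟨ sum-cong n (λ x → sum-cong n (λ y → sum-cong n (λ z →
         cong₂ (λ i t → δ i n t) (rotateℕ z x y) (rotateℤ (h z) (f x) (g y))))) ⟩
  cube f g h n ∎
  where
  open ≡-Reasoning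
  rotateℕ : ∀ z x y → z ℕ.+ (x ℕ.+ y) ≡ x ℕ.+ (y ℕ.+ z)
  rotateℕ z x y = trans (ℕP.+-comm z (x ℕ.+ y)) (ℕP.+-assoc x y z)
  rotateℤ : ∀ c a b → c * (a * b) ≡ a * (b * c)
  rotateℤ = solve-∀

-- Associativity from commutativity and the rotation symmetry of the cube.
⊛-assoc : ∀ f g h → (f ⊛ g) ⊛ h ≗ f ⊛ (g ⊛ h)
⊛-assoc f g h n = begin
  ((f ⊛ g) ⊛ h) n   ≡⟨ ⊛-comm (f ⊛ g) h n ⟩
  (h ⊛ (f ⊛ g)) n   ≡⟨ ⊛-as-cube h f g n ⟩
  cube h f g n      ≡⟨ cube-rotate f g h n ⟩
  cube f g h n      ≡⟨ ⊛-as-cube f g h n ⟨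
  (f ⊛ (g ⊛ h)) n   ∎
  where open ≡-Reasoning

⊛-identityˡ : ∀ f → oneS ⊛ f ≗ f
⊛-identityˡ f zero    = ℤP.*-identityˡ (f 0)
⊛-identityˡ f (suc n) = begin
  (oneS ⊛ f) (suc n)
    ≡⟨ sum-uncons n (λ i → oneS i * f (suc n ℕ.∸ i)) ⟩
  + 1 * f (suc n) + sumTo n (λ i → +0 * f (n ℕ.∸ i))
    ≡⟨ cong₂ _+_ (ℤP.*-identityˡ (f (suc n))) (sum-zero n (λ i _ → ℤP.*-zeroˡ (f (n ℕ.∸ i)))) ⟩
  f (suc n) + +0
    ≡⟨ ℤP.+-identityʳ (f (suc n)) ⟩
  f (suc n) ∎
  where open ≡-Reasoning

⊛-identityʳ : ∀ f → f ⊛ oneS ≗ f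
⊛-identityʳ f n = trans (⊛-comm f oneS n) (⊛-identityˡ f n)

series-monoid : CommutativeMonoid 0ℓ 0ℓ
series-monoid = record
  { Carrier = Series
  ; _≈_     = _≗_
  ; _∙_     = _⊛_
  ; ε       = oneS
  ; isCommutativeMonoid = record
    { isMonoid = record
      { isSemigroup = record
        { isMagma = record
          { isEquivalence = record
            { refl  = λ _ → refl
            ; sym   = λ f≗g i → sym (f≗g i)
            ; trans = λ f≗g g≗h i → trans (f≗g i) (g≗h i) }
          ; ∙-cong = ⊛-cong }
        ; assoc = ⊛-assoc }
      ; identity = ⊛-identityˡ , ⊛-identityʳ }
    ; comm = ⊛-comm } }

open CommutativeMonoid series-monoid using ()
  renaming (refl to ≗-refl; sym to ≗-sym; trans to ≗-trans; setoid to series-setoid)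
open import Algebra.Properties.CommutativeSemigroup
  (CommutativeMonoid.commutativeSemigroup series-monoid) using (interchange; x∙yz≈y∙xz)
open import Algebra.Properties.CommutativeMonoid.Mult series-monoid using (_×_; ×-homo-+; ×-distrib-+)
module ≗-Reasoning = Relation.Binary.Reasoning.Setoid series-setoid

powS≗× : ∀ f e → powS f e ≗ e × f
powS≗× f zero    = ≗-refl
powS≗× f (suc e) = ⊛-congʳ f (powS≗× f e)

powS-cong : ∀ {f f′} e → f ≗ f′ → powS f e ≗ powS f′ e
powS-cong zero    f≗f′ = ≗-refl
powS-cong (suc e) f≗f′ = ⊛-cong f≗f′ (powS-cong e f≗f′)

powS-+ : ∀ f a c → powS f (a ℕ.+ c) ≗ powS f a ⊛ powS f c
powS-+ f a c = begin
  powS f (a ℕ.+ c)      ≈⟨ powS≗× f (a ℕ.+ c) ⟩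
  (a ℕ.+ c) × f         ≈⟨ ×-homo-+ f a c ⟩
  (a × f) ⊛ (c × f)     ≈⟨ ⊛-cong (powS≗× f a) (powS≗× f c) ⟨
  powS f a ⊛ powS f c   ∎
  where open ≗-Reasoning

powS-⊛ : ∀ f g e → powS (f ⊛ g) e ≗ powS f e ⊛ powS g e
powS-⊛ f g e = begin
  powS (f ⊛ g) e        ≈⟨ powS≗× (f ⊛ g) e ⟩
  e × (f ⊛ g)           ≈⟨ ×-distrib-+ f g e ⟩
  (e × f) ⊛ (e × g)     ≈⟨ ⊛-cong (powS≗× f e) (powS≗× g e) ⟨
  powS f e ⊛ powS g e   ∎
  where open ≗-Reasoning

powS-one : ∀ e → powS oneS e ≗ oneS
powS-one zero    = ≗-refl
powS-one (suc e) = ≗-trans (⊛-congʳ oneS (powS-one e)) (⊛-identityˡ oneS)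

prodS-cong : ∀ L {F G : ℕ → Series} e → (∀ l → F l ≗ G l) → prodS L F e ≗ prodS L G e
prodS-cong zero    e F≗G = ≗-refl
prodS-cong (suc L) e F≗G = ⊛-cong (prodS-cong L e F≗G) (powS-cong (e L) (F≗G L))

prodS-cong-exp : ∀ L (F : ℕ → Series) {e e′} → e ≗ e′ → prodS L F e ≗ prodS L F e′
prodS-cong-exp zero    F e≗e′ = ≗-refl
prodS-cong-exp (suc L) F {e′ = e′} e≗e′ rewrite e≗e′ L = ⊛-congˡ (powS (F L) (e′ L)) (prodS-cong-exp L F e≗e′)

prodS-+ : ∀ L F e₁ e₂ → prodS L F (λ l → e₁ l ℕ.+ e₂ l) ≗ prodS L F e₁ ⊛ prodS L F e₂
prodS-+ zero    F e₁ e₂ = ≗-sym (⊛-identityˡ oneS)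
prodS-+ (suc L) F e₁ e₂ =
  ≗-trans (⊛-cong (prodS-+ L F e₁ e₂) (powS-+ (F L) (e₁ L) (e₂ L)))
          (interchange (prodS L F e₁) (prodS L F e₂) (powS (F L) (e₁ L)) (powS (F L) (e₂ L)))

prodS-⊛ : ∀ L F G e → prodS L F e ⊛ prodS L G e ≗ prodS L (λ l → F l ⊛ G l) e
prodS-⊛ zero    F G e = ⊛-identityˡ oneS
prodS-⊛ (suc L) F G e =
  ≗-trans (interchange (prodS L F e) (powS (F L) (e L)) (prodS L G e) (powS (G L) (e L)))
          (⊛-cong (prodS-⊛ L F G e) (≗-sym (powS-⊛ (F L) (G L) (e L))))

prodS-ones : ∀ L F e → (∀ l → F l ≗ oneS) → prodS L F e ≗ oneS
prodS-ones zero    F e F≗1 = ≗-refl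
prodS-ones (suc L) F e F≗1 =
  ≗-trans (⊛-cong (prodS-ones L F e F≗1) (≗-trans (powS-cong (e L) (F≗1 L)) (powS-one (e L))))
          (⊛-identityˡ oneS)

prodS-truncate : ∀ L L′ F e → L ℕ.≤ L′ → (∀ l → L ℕ.≤ l → e l ≡ 0) → prodS L′ F e ≗ prodS L F e
prodS-truncate L zero     F e z≤n   e≡0 = ≗-refl
prodS-truncate L (suc L′) F e L≤1+L′ e≡0 with L ℕ.≟ suc L′
... | yes refl = ≗-refl
... | no  L≢   = ≗-trans (⊛-congʳ (prodS L′ F e) (unit (e≡0 L′ L≤L′)))
                         (≗-trans (⊛-identityʳ (prodS L′ F e)) (prodS-truncate L L′ F e L≤L′ e≡0))
  where
  L≤L′ = ℕP.≤-pred (ℕP.≤∧≢⇒< L≤1+L′ L≢)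
  unit : ∀ {k} → k ≡ 0 → powS (F L′) k ≗ oneS
  unit refl = ≗-refl

shift : ℕ → Series → Series
shift zero    f         = f
shift (suc k) f zero    = +0
shift (suc k) f (suc i) = shift k f i

shift-cong : ∀ k {f g} → f ≗ g → shift k f ≗ shift k g
shift-cong zero    f≗g         = f≗g
shift-cong (suc k) f≗g zero    = refl
shift-cong (suc k) f≗g (suc i) = shift-cong k f≗g i

shift-+ : ∀ a c f → shift a (shift c f) ≗ shift (a ℕ.+ c) f
shift-+ zero    c f         = ≗-refl
shift-+ (suc a) c f zero    = refl
shift-+ (suc a) c f (suc i) = shift-+ a c f i

shift-≥ : ∀ k f i → k ℕ.≤ i → shift k f i ≡ f (i ℕ.∸ k)
shift-≥ zero    f i       k≤i       = refl
shift-≥ (suc k) f (suc i) (s≤s k≤i) = shift-≥ k f i k≤i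

shift-< : ∀ k f i → i ℕ.< k → shift k f i ≡ +0
shift-< (suc k) f zero    i<k       = refl
shift-< (suc k) f (suc i) (s≤s i<k) = shift-< k f i i<k

shift-⊛ˡ : ∀ k f g → shift k f ⊛ g ≗ shift k (f ⊛ g)
shift-⊛ˡ zero    f g = ≗-refl
shift-⊛ˡ (suc k) f g = begin
  shift (suc k) f ⊛ g          ≈⟨ ⊛-congˡ g (≗-sym (shift-+ 1 k f)) ⟩
  shift 1 (shift k f) ⊛ g      ≈⟨ shift1-⊛ (shift k f) ⟩
  shift 1 (shift k f ⊛ g)      ≈⟨ shift-cong 1 (shift-⊛ˡ k f g) ⟩
  shift 1 (shift k (f ⊛ g))    ≈⟨ shift-+ 1 k (f ⊛ g) ⟩
  shift (suc k) (f ⊛ g)        ∎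
  where
  open ≗-Reasoning
  shift1-⊛ : ∀ h → shift 1 h ⊛ g ≗ shift 1 (h ⊛ g)
  shift1-⊛ h zero    = refl
  shift1-⊛ h (suc n) = trans (sum-uncons n (λ i → shift 1 h i * g (suc n ℕ.∸ i))) (ℤP.+-identityˡ _)

shift-⊛ : ∀ a c f g → shift a f ⊛ shift c g ≗ shift (a ℕ.+ c) (f ⊛ g)
shift-⊛ a c f g = begin
  shift a f ⊛ shift c g          ≈⟨ shift-⊛ˡ a f (shift c g) ⟩
  shift a (f ⊛ shift c g)        ≈⟨ shift-cong a (⊛-comm f (shift c g)) ⟩
  shift a (shift c g ⊛ f)        ≈⟨ shift-cong a (shift-⊛ˡ c g f) ⟩
  shift a (shift c (g ⊛ f))      ≈⟨ shift-cong a (shift-cong c (⊛-comm g f)) ⟩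
  shift a (shift c (f ⊛ g))      ≈⟨ shift-+ a c (f ⊛ g) ⟩
  shift (a ℕ.+ c) (f ⊛ g)        ∎
  where open ≗-Reasoning

powS-shift : ∀ d f e → powS (shift d f) e ≗ shift (e ℕ.* d) (powS f e)
powS-shift d f zero    = ≗-refl
powS-shift d f (suc e) = ≗-trans (⊛-congʳ (shift d f) (powS-shift d f e)) (shift-⊛ d (e ℕ.* d) f (powS f e))

weight : ℕ → (ℕ → ℕ) → (ℕ → ℕ) → ℕ
weight zero    d e = 0
weight (suc L) d e = weight L d e ℕ.+ e L ℕ.* d L

prodS-shift : ∀ L d G e → prodS L (λ l → shift (d l) (G l)) e ≗ shift (weight L d e) (prodS L G e)
prodS-shift zero    d G e = ≗-refl
prodS-shift (suc L) d G e =
  ≗-trans (⊛-cong (prodS-shift L d G e) (powS-shift (d L) (G L) (e L)))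
          (shift-⊛ (weight L d e) (e L ℕ.* d L) (prodS L G e) (powS (G L) (e L)))

DegreeAtMost : ℕ → Series → Set
DegreeAtMost D f = ∀ i → D ℕ.< i → f i ≡ +0

-- f is a polynomial with xᴰ f(1/x) = f(x): its coefficient list is a palindrome of length D+1.
Palindromic : ℕ → Series → Set
Palindromic D f = ∀ i → i ℕ.≤ D → f (D ℕ.∸ i) ≡ f i

OnMultiplesOf : ℕ → Series → Set
OnMultiplesOf D f = ∀ i → ¬ D ∣ i → f i ≡ +0

degree-one : DegreeAtMost 0 oneS
degree-one (suc i) _ = refl

palindromic-one : Palindromic 0 oneS
palindromic-one zero _ = refl

multiples-one : ∀ D → OnMultiplesOf D oneS
multiples-one D zero    D∤0 = ⊥-elim (D∤0 (D ∣0))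
multiples-one D (suc i) _   = refl

degree-onePlusX : ∀ d → DegreeAtMost d (onePlusX d)
degree-onePlusX d i d<i =
  cong₂ _+_ (δ-other {i} {0} (+ 1) (λ { refl → ℕP.<⇒≱ d<i z≤n }))
            (δ-other {i} {d} (+ 1) (λ { refl → ℕP.<-irrefl refl d<i }))

palindromic-onePlusX : ∀ d → Palindromic d (onePlusX d)
palindromic-onePlusX d i i≤d = trans (cong₂ _+_ (δ-cong (+ 1) to-d from-d) (δ-cong (+ 1) to-0 from-0))
                                     (ℤP.+-comm (δ i d (+ 1)) (δ i 0 (+ 1)))
  where
  to-d : d ℕ.∸ i ≡ 0 → i ≡ d
  to-d d∸i≡0 = trans (sym (ℕP.m∸[m∸n]≡n i≤d)) (cong (d ℕ.∸_) d∸i≡0)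
  from-d : i ≡ d → d ℕ.∸ i ≡ 0
  from-d refl = ℕP.n∸n≡0 d
  to-0 : d ℕ.∸ i ≡ d → i ≡ 0
  to-0 d∸i≡d = trans (sym (ℕP.m∸[m∸n]≡n i≤d)) (trans (cong (d ℕ.∸_) d∸i≡d) (ℕP.n∸n≡0 d))
  from-0 : i ≡ 0 → d ℕ.∸ i ≡ d
  from-0 refl = refl

multiples-onePlusX : ∀ D d → D ∣ d → OnMultiplesOf D (onePlusX d)
multiples-onePlusX D d D∣d i D∤i =
  cong₂ _+_ (δ-other {i} {0} (+ 1) (λ { refl → D∤i (D ∣0) })) (δ-other {i} {d} (+ 1) (λ { refl → D∤i D∣d }))

degree-⊛ : ∀ D₁ D₂ {f g} → DegreeAtMost D₁ f → DegreeAtMost D₂ g → DegreeAtMost (D₁ ℕ.+ D₂) (f ⊛ g)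
degree-⊛ D₁ D₂ {f} {g} deg-f deg-g n D<n = sum-zero n term
  where
  term : ∀ a → a ℕ.≤ n → f a * g (n ℕ.∸ a) ≡ +0
  term a _ with a ℕ.≤? D₁
  ... | yes a≤D₁ = trans (cong (f a *_) (deg-g (n ℕ.∸ a) D₂<n∸a)) (ℤP.*-zeroʳ (f a))
    where
    D₂<n∸a : D₂ ℕ.< n ℕ.∸ a
    D₂<n∸a = ℕP.m+n≤o⇒m≤o∸n (suc D₂)
               (ℕP.≤-trans (s≤s (ℕP.≤-trans (ℕP.+-monoʳ-≤ D₂ a≤D₁) (ℕP.≤-reflexive (ℕP.+-comm D₂ D₁)))) D<n)
  ... | no  a≰D₁ = trans (cong (_* g (n ℕ.∸ a)) (deg-f a (ℕP.≰⇒> a≰D₁))) (ℤP.*-zeroˡ (g (n ℕ.∸ a)))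

∸-+-interchange : ∀ D₁ D₂ {a c} → a ℕ.≤ D₁ → c ℕ.≤ D₂ → (D₁ ℕ.∸ a) ℕ.+ (D₂ ℕ.∸ c) ≡ (D₁ ℕ.+ D₂) ℕ.∸ (a ℕ.+ c)
∸-+-interchange D₁ D₂ {a} {c} a≤D₁ c≤D₂ = begin
  (D₁ ℕ.∸ a) ℕ.+ (D₂ ℕ.∸ c)    ≡⟨ ℕP.+-∸-assoc (D₁ ℕ.∸ a) c≤D₂ ⟨
  (D₁ ℕ.∸ a) ℕ.+ D₂ ℕ.∸ c      ≡⟨ cong (ℕ._∸ c) (ℕP.+-∸-comm D₂ a≤D₁) ⟨
  D₁ ℕ.+ D₂ ℕ.∸ a ℕ.∸ c        ≡⟨ ℕP.∸-+-assoc (D₁ ℕ.+ D₂) a c ⟩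
  (D₁ ℕ.+ D₂) ℕ.∸ (a ℕ.+ c)    ∎
  where open ≡-Reasoning

-- Palindromes multiply to palindromes: reflect both summation indices of the rectangle sum.
palindromic-⊛ : ∀ D₁ D₂ {f g} → DegreeAtMost D₁ f → DegreeAtMost D₂ g →
                Palindromic D₁ f → Palindromic D₂ g → Palindromic (D₁ ℕ.+ D₂) (f ⊛ g)
palindromic-⊛ D₁ D₂ {f} {g} deg-f deg-g pal-f pal-g i i≤D = begin
  (f ⊛ g) (D ℕ.∸ i)
    ≡⟨ ⊛-as-rectangle D₁ D₂ (D ℕ.∸ i) f g (λ a D₁<a _ → deg-f a D₁<a) (λ c D₂<c _ → deg-g c D₂<c) ⟩
  sumTo D₁ (λ a → sumTo D₂ (λ c → δ (a ℕ.+ c) (D ℕ.∸ i) (f a * g c)))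
    ≡⟨ trans (sum-reverse D₁ _) (sum-cong D₁ (λ a → sum-reverse D₂ _)) ⟩
  sumTo D₁ (λ a → sumTo D₂ (λ c → δ ((D₁ ℕ.∸ a) ℕ.+ (D₂ ℕ.∸ c)) (D ℕ.∸ i) (f (D₁ ℕ.∸ a) * g (D₂ ℕ.∸ c))))
    ≡⟨ sum-cong≤ D₁ (λ a a≤D₁ → sum-cong≤ D₂ (λ c c≤D₂ → reflect a c a≤D₁ c≤D₂)) ⟩
  sumTo D₁ (λ a → sumTo D₂ (λ c → δ (a ℕ.+ c) i (f a * g c)))
    ≡⟨ ⊛-as-rectangle D₁ D₂ i f g (λ a D₁<a _ → deg-f a D₁<a) (λ c D₂<c _ → deg-g c D₂<c) ⟨
  (f ⊛ g) i ∎
  where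
  open ≡-Reasoning
  D = D₁ ℕ.+ D₂
  reflect : ∀ a c → a ℕ.≤ D₁ → c ℕ.≤ D₂ →
            δ ((D₁ ℕ.∸ a) ℕ.+ (D₂ ℕ.∸ c)) (D ℕ.∸ i) (f (D₁ ℕ.∸ a) * g (D₂ ℕ.∸ c)) ≡ δ (a ℕ.+ c) i (f a * g c)
  reflect a c a≤D₁ c≤D₂ = trans (cong₂ (λ u v → δ _ (D ℕ.∸ i) (u * v)) (pal-f a a≤D₁) (pal-g c c≤D₂))
                                (δ-cong (f a * g c) to from)
    where
    split = ∸-+-interchange D₁ D₂ a≤D₁ c≤D₂
    to : (D₁ ℕ.∸ a) ℕ.+ (D₂ ℕ.∸ c) ≡ D ℕ.∸ i → a ℕ.+ c ≡ i
    to e = ℕP.∸-cancelˡ-≡ (ℕP.+-mono-≤ a≤D₁ c≤D₂) i≤D (trans (sym split) e)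
    from : a ℕ.+ c ≡ i → (D₁ ℕ.∸ a) ℕ.+ (D₂ ℕ.∸ c) ≡ D ℕ.∸ i
    from e = trans split (cong (D ℕ.∸_) e)

-- Supports on multiples of D are closed under products, as D ∣ a and D ∣ n − a force D ∣ n.
multiples-⊛ : ∀ D {f g} → OnMultiplesOf D f → OnMultiplesOf D g → OnMultiplesOf D (f ⊛ g)
multiples-⊛ D {f} {g} mult-f mult-g n D∤n = sum-zero n term
  where
  term : ∀ a → a ℕ.≤ n → f a * g (n ℕ.∸ a) ≡ +0
  term a a≤n with D ∣? a
  ... | yes D∣a = trans (cong (f a *_) (mult-g (n ℕ.∸ a) (λ D∣n∸a → D∤n (∣m∸n∣n⇒∣m D a≤n D∣n∸a D∣a))))
                        (ℤP.*-zeroʳ (f a))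
  ... | no  D∤a = trans (cong (_* g (n ℕ.∸ a)) (mult-f a D∤a)) (ℤP.*-zeroˡ (g (n ℕ.∸ a)))

ind-multiples : ∀ D f → OnMultiplesOf D f → ∀ j z → ind ⌊ D ∣? j ⌋ (f j * z) ≡ f j * z
ind-multiples D f mult j z with D ∣? j
... | yes _   = refl
... | no  D∤j = sym (trans (cong (_* z) (mult j D∤j)) (ℤP.*-zeroˡ z))

degree-powS : ∀ d {f} e → DegreeAtMost d f → DegreeAtMost (e ℕ.* d) (powS f e)
degree-powS d zero    deg-f = degree-one
degree-powS d (suc e) deg-f = degree-⊛ d (e ℕ.* d) deg-f (degree-powS d e deg-f)

palindromic-powS : ∀ d {f} e → DegreeAtMost d f → Palindromic d f → Palindromic (e ℕ.* d) (powS f e)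
palindromic-powS d zero    deg-f pal-f = palindromic-one
palindromic-powS d (suc e) deg-f pal-f =
  palindromic-⊛ d (e ℕ.* d) deg-f (degree-powS d e deg-f) pal-f (palindromic-powS d e deg-f pal-f)

multiples-powS : ∀ D {f} e → OnMultiplesOf D f → OnMultiplesOf D (powS f e)
multiples-powS D zero    mult-f = multiples-one D
multiples-powS D (suc e) mult-f = multiples-⊛ D mult-f (multiples-powS D e mult-f)

degree-prodS : ∀ L d F e → (∀ l → DegreeAtMost (d l) (F l)) → DegreeAtMost (weight L d e) (prodS L F e)
degree-prodS zero    d F e deg = degree-one
degree-prodS (suc L) d F e deg =
  degree-⊛ (weight L d e) (e L ℕ.* d L) (degree-prodS L d F e deg) (degree-powS (d L) (e L) (deg L))

palindromic-prodS : ∀ L d F e → (∀ l → DegreeAtMost (d l) (F l)) → (∀ l → Palindromic (d l) (F l)) →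
                    Palindromic (weight L d e) (prodS L F e)
palindromic-prodS zero    d F e deg pal = palindromic-one
palindromic-prodS (suc L) d F e deg pal =
  palindromic-⊛ (weight L d e) (e L ℕ.* d L) (degree-prodS L d F e deg) (degree-powS (d L) (e L) (deg L))
                (palindromic-prodS L d F e deg pal) (palindromic-powS (d L) (e L) (deg L) (pal L))

multiples-prodS : ∀ D L F e → (∀ l → l ℕ.< L → OnMultiplesOf D (powS (F l) (e l))) →
                  OnMultiplesOf D (prodS L F e)
multiples-prodS D zero    F e mult = multiples-one D
multiples-prodS D (suc L) F e mult =
  multiples-⊛ D (multiples-prodS D L F e (λ l l<L → mult l (ℕP.m≤n⇒m≤1+n l<L))) (mult L ℕP.≤-refl)

onePlusX-⊛ : ∀ d g n →
             (onePlusX d ⊛ g) n ≡ sumTo n (λ i → δ i 0 (g (n ℕ.∸ i))) + sumTo n (λ i → δ i d (g (n ℕ.∸ i)))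
onePlusX-⊛ d g n = trans (sum-cong n term) (sum-+ n _ _)
  where
  term : ∀ i → onePlusX d i * g (n ℕ.∸ i) ≡ δ i 0 (g (n ℕ.∸ i)) + δ i d (g (n ℕ.∸ i))
  term i = trans (ℤP.*-distribʳ-+ (g (n ℕ.∸ i)) (δ i 0 (+ 1)) (δ i d (+ 1)))
                 (cong₂ _+_ (trans (δ-natural (_* g (n ℕ.∸ i)) refl i 0 (+ 1)) (cong (δ i 0) (ℤP.*-identityˡ _)))
                            (trans (δ-natural (_* g (n ℕ.∸ i)) refl i d (+ 1)) (cong (δ i d) (ℤP.*-identityˡ _))))

onePlusX-⊛-≥ : ∀ d g n → d ℕ.≤ n → (onePlusX d ⊛ g) n ≡ g n + g (n ℕ.∸ d)
onePlusX-⊛-≥ d g n d≤n =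
  trans (onePlusX-⊛ d g n) (cong₂ _+_ (sum-δ n 0 (λ i → g (n ℕ.∸ i)) z≤n) (sum-δ n d (λ i → g (n ℕ.∸ i)) d≤n))

onePlusX-⊛-< : ∀ d g n → n ℕ.< d → (onePlusX d ⊛ g) n ≡ g n
onePlusX-⊛-< d g n n<d =
  trans (onePlusX-⊛ d g n)
        (trans (cong₂ _+_ (sum-δ n 0 (λ i → g (n ℕ.∸ i)) z≤n) (sum-δ-out n d (λ i → g (n ℕ.∸ i)) n<d))
               (ℤP.+-identityʳ (g n)))

module _ (d : ℕ) .{{_ : NonZero d}} where

  private
    0<d : 0 ℕ.< d
    0<d = ℕ.>-nonZero⁻¹ d

    ∤-small : ∀ i → 0 ℕ.< i → i ℕ.< d → ¬ d ∣ i
    ∤-small (suc i) _ i<d d∣i = ℕP.<⇒≱ i<d (∣⇒≤ d∣i)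

    ∣⇒∣∸ : ∀ {n} → d ℕ.≤ n → d ∣ n → d ∣ n ℕ.∸ d
    ∣⇒∣∸ d≤n d∣n = ∣m+n∣m⇒∣n (subst (d ∣_) (sym (ℕP.m+[n∸m]≡n d≤n)) d∣n) ∣-refl

    ∣∸⇒∣ : ∀ {n} → d ℕ.≤ n → d ∣ n ℕ.∸ d → d ∣ n
    ∣∸⇒∣ d≤n d∣n∸d = ∣m∸n∣n⇒∣m d d≤n d∣n∸d ∣-refl

  -- (1 + x^d) · Σ_t (-1)^t x^{dt} = 1: consecutive terms cancel.
  invInX-inverse : onePlusX d ⊛ invInX d ≗ oneS
  invInX-inverse zero = begin
    (onePlusX d ⊛ invInX d) 0   ≡⟨ onePlusX-⊛-< d (invInX d) 0 0<d ⟩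
    invInX d 0                  ≡⟨ ind-yes (d ∣? 0) _ (d ∣0) ⟩
    sign (0 / d)                ≡⟨ cong sign (0/n≡0 d) ⟩
    + 1                         ∎
    where open ≡-Reasoning
  invInX-inverse (suc m) with suc m ℕ.<? d
  ... | yes 1+m<d = trans (onePlusX-⊛-< d (invInX d) (suc m) 1+m<d)
                          (ind-no (d ∣? suc m) _ (∤-small (suc m) (s≤s z≤n) 1+m<d))
  ... | no  1+m≮d with d ∣? suc m
  ...   | yes d∣1+m = begin
    (onePlusX d ⊛ invInX d) (suc m)
      ≡⟨ onePlusX-⊛-≥ d (invInX d) (suc m) d≤1+m ⟩
    invInX d (suc m) + invInX d (suc m ℕ.∸ d)
      ≡⟨ cong₂ _+_ (trans (ind-yes (d ∣? suc m) _ d∣1+m) (cong sign (m/n≡1+[m∸n]/n d≤1+m)))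
                   (ind-yes (d ∣? (suc m ℕ.∸ d)) _ (∣⇒∣∸ d≤1+m d∣1+m)) ⟩
    - sign ((suc m ℕ.∸ d) / d) + sign ((suc m ℕ.∸ d) / d)
      ≡⟨ ℤP.+-inverseˡ (sign ((suc m ℕ.∸ d) / d)) ⟩
    +0 ∎
    where
    open ≡-Reasoning
    d≤1+m = ℕP.≮⇒≥ 1+m≮d
  ...   | no  d∤1+m = trans (onePlusX-⊛-≥ d (invInX d) (suc m) d≤1+m)
                            (cong₂ _+_ (ind-no (d ∣? suc m) _ d∤1+m)
                                       (ind-no (d ∣? (suc m ℕ.∸ d)) _ (d∤1+m ∘ ∣∸⇒∣ d≤1+m)))
    where d≤1+m = ℕP.≮⇒≥ 1+m≮d

  -- Expanding in y = 1/x gives the expansion in x shifted by d:  (1 + y^{-d})^{-1} = y^d (1 + y^d)^{-1}.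
  invInY-shift : invInY d ≗ shift d (invInX d)
  invInY-shift zero = sym (shift-< d (invInX d) 0 0<d)
  invInY-shift (suc j) with suc j ℕ.<? d
  ... | yes 1+j<d = trans (ind-no (d ∣? suc j) _ (∤-small (suc j) (s≤s z≤n) 1+j<d))
                          (sym (shift-< d (invInX d) (suc j) 1+j<d))
  ... | no  1+j≮d = trans (ind-cong (d ∣? suc j) (d ∣? (suc j ℕ.∸ d)) (∣⇒∣∸ d≤1+j) (∣∸⇒∣ d≤1+j) (λ _ → quotient))
                          (sym (shift-≥ d (invInX d) (suc j) d≤1+j))
    where
    d≤1+j = ℕP.≮⇒≥ 1+j≮d
    quotient : sign ((suc j / d) ℕ.∸ 1) ≡ sign ((suc j ℕ.∸ d) / d)
    quotient = cong sign (trans (sym (ℕP.pred[m∸n]≡m∸[1+n] (suc j / d) 0)) (sym ([m∸n]/n≡m/n∸1 (suc j) d)))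

-- Writing n = N + A and N = C + P, the upper arguments −n + N, −n + P and N − P of the
-- proposition become −A, −(A + C) and C.
−n+N≡−A : ∀ {n N A} → n ≡ N ℕ.+ A → - (+ n) + + N ≡ - (+ A)
−n+N≡−A {N = N} {A} refl = trans (cong (λ t → - t + + N) (ℤP.pos-+ N A)) (ring (+ N) (+ A))
  where
  ring : ∀ x a → - (x + a) + x ≡ - a
  ring = solve-∀

−n+P≡−[A+C] : ∀ {n N A C P} → n ≡ N ℕ.+ A → N ≡ C ℕ.+ P → - (+ n) + + P ≡ - (+ (A ℕ.+ C))
−n+P≡−[A+C] {A = A} {C} {P} refl refl =
  trans (cong (λ t → - t + + P) (trans (ℤP.pos-+ (C ℕ.+ P) A) (cong (_+ + A) (ℤP.pos-+ C P))))
        (trans (ring (+ C) (+ P) (+ A)) (cong -_ (sym (ℤP.pos-+ A C))))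
  where
  ring : ∀ c p a → - ((c + p) + a) + p ≡ - (a + c)
  ring = solve-∀

N−P≡C : ∀ {N C P} → N ≡ C ℕ.+ P → + N - + P ≡ + C
N−P≡C {C = C} {P} refl = trans (cong (_- + P) (ℤP.pos-+ C P)) (ring (+ C) (+ P))
  where
  ring : ∀ c p → (c + p) - p ≡ c
  ring = solve-∀

neg-≤-neg : ∀ {B K} → 1 ℕ.≤ B → -[1+ K ] ℤ.≤ - (+ B) → B ℕ.≤ suc K
neg-≤-neg {suc B} _ (-≤- B≤K) = s≤s B≤K

nonneg-≰-neg : ∀ {B K} → 1 ℕ.≤ B → ¬ (+ K ℤ.≤ - (+ B))
nonneg-≰-neg {suc B} _ ()

module Digits (b : ℕ) .{{_ : NonZero b}} (b≥2 : 2 ℕ.≤ b) where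

  b^-nonZero : ∀ l → NonZero (b ^ l)
  b^-nonZero l = ℕP.m^n≢0 b l

  infixl 7 _/b^_
  _/b^_ : ℕ → ℕ → ℕ
  R /b^ l = (R / b ^ l) {{b^-nonZero l}}

  digit-small : ∀ {R} l → R ℕ.< b ^ l → digit b R l ≡ 0
  digit-small l R<b^l = trans (cong (_% b) (m<n⇒m/n≡0 {{b^-nonZero l}} R<b^l)) (m<n⇒m%n≡m (ℕ.>-nonZero⁻¹ b))

  digit-zero : ∀ l → digit b 0 l ≡ 0
  digit-zero l = digit-small l (ℕP.m^n>0 b l)

  n<b^n : ∀ n → n ℕ.< b ^ n
  n<b^n zero    = s≤s z≤n
  n<b^n (suc n) = begin-strict
    suc n                   <⟨ ℕP.+-mono-≤ (ℕP.m^n>0 b n) (n<b^n n) ⟩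
    b ^ n ℕ.+ b ^ n         ≡⟨ cong (b ^ n ℕ.+_) (ℕP.+-identityʳ (b ^ n)) ⟨
    2 ℕ.* b ^ n             ≤⟨ ℕP.*-monoˡ-≤ (b ^ n) b≥2 ⟩
    b ^ suc n               ∎
    where open ℕP.≤-Reasoning

  digit-beyond : ∀ {R} l → R ℕ.< l → digit b R l ≡ 0
  digit-beyond l R<l = digit-small l (ℕP.<-trans R<l (n<b^n l))

  pow-split : ∀ {t} l → l ℕ.≤ t → b ^ t ≡ b ^ (t ℕ.∸ l) ℕ.* b ^ l
  pow-split {t} l l≤t = trans (cong (b ^_) (sym (ℕP.m∸n+n≡m l≤t))) (ℕP.^-distribˡ-+-* b (t ℕ.∸ l) l)

  digit-expansion : ∀ R L → weight L (b ^_) (digit b R) ℕ.+ (R /b^ L) ℕ.* b ^ L ≡ R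
  digit-expansion R zero    = trans (ℕP.*-identityʳ (R / 1)) (n/1≡n R)
  digit-expansion R (suc L) = begin
    W ℕ.+ digit b R L ℕ.* b ^ L ℕ.+ (R /b^ suc L) ℕ.* b ^ suc L
      ≡⟨ cong (λ q → W ℕ.+ digit b R L ℕ.* b ^ L ℕ.+ q ℕ.* b ^ suc L) next-quotient ⟩
    W ℕ.+ (Q % b) ℕ.* b ^ L ℕ.+ (Q / b) ℕ.* (b ℕ.* b ^ L)
      ≡⟨ regroup W (Q % b) (Q / b) b (b ^ L) ⟩
    W ℕ.+ (Q % b ℕ.+ (Q / b) ℕ.* b) ℕ.* b ^ L
      ≡⟨ cong (λ q → W ℕ.+ q ℕ.* b ^ L) (m≡m%n+[m/n]*n Q b) ⟨
    W ℕ.+ Q ℕ.* b ^ L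
      ≡⟨ digit-expansion R L ⟩
    R ∎
    where
    open ≡-Reasoning
    W = weight L (b ^_) (digit b R)
    Q = R /b^ L
    b^L*b-nonZero = ℕP.m*n≢0 (b ^ L) b {{b^-nonZero L}}
    next-quotient : R /b^ suc L ≡ Q / b
    next-quotient = sym (trans (m/n/o≡m/[n*o] R (b ^ L) b {{b^-nonZero L}} {{_}} {{b^L*b-nonZero}})
                               (/-congʳ {{b^L*b-nonZero}} {{b^-nonZero (suc L)}} (ℕP.*-comm (b ^ L) b)))
    regroup : ∀ w r q c p → w ℕ.+ r ℕ.* p ℕ.+ q ℕ.* (c ℕ.* p) ≡ w ℕ.+ (r ℕ.+ q ℕ.* c) ℕ.* p
    regroup = ℕSolver.solve-∀

  weight-digits : ∀ R → weight (suc R) (b ^_) (digit b R) ≡ R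
  weight-digits R = trans (sym (ℕP.+-identityʳ _))
                          (trans (cong (weight (suc R) (b ^_) (digit b R) ℕ.+_) (sym high))
                                 (digit-expansion R (suc R)))
    where
    high : (R /b^ suc R) ℕ.* b ^ suc R ≡ 0
    high = cong (ℕ._* b ^ suc R) (m<n⇒m/n≡0 {{b^-nonZero (suc R)}} (ℕP.<-trans (ℕP.n<1+n R) (n<b^n (suc R))))

  low-digits-zero : ∀ n s → (∀ l → l ℕ.< s → digit b n l ≡ 0) → (n /b^ s) ℕ.* b ^ s ≡ n
  low-digits-zero n s low = trans (cong (ℕ._+ (n /b^ s) ℕ.* b ^ s) (sym (weight-zero s low)))
                                  (digit-expansion n s)
    where
    weight-zero : ∀ L → (∀ l → l ℕ.< L → digit b n l ≡ 0) → weight L (b ^_) (digit b n) ≡ 0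
    weight-zero zero    _    = refl
    weight-zero (suc L) low′ = cong₂ ℕ._+_ (weight-zero L (λ l l<L → low′ l (ℕP.m≤n⇒m≤1+n l<L)))
                                          (cong (ℕ._* b ^ L) (low′ L ℕP.≤-refl))

  digit-low : ∀ Y Z {t} l → l ℕ.< t → digit b (Y ℕ.* b ^ t ℕ.+ Z) l ≡ digit b Z l
  digit-low Y Z {t} l l<t = begin
    ((Y ℕ.* b ^ t ℕ.+ Z) /b^ l) % b
      ≡⟨ cong (λ p → ((p ℕ.+ Z) /b^ l) % b) (trans (cong (Y ℕ.*_) (pow-split l (ℕP.<⇒≤ l<t)))
                                                    (sym (ℕP.*-assoc Y (b ^ (t ℕ.∸ l)) (b ^ l)))) ⟩
    ((Y′ ℕ.* b ^ l ℕ.+ Z) /b^ l) % b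
      ≡⟨ cong (_% b) (+-distrib-/-∣ˡ Z {{b^-nonZero l}} (n∣m*n Y′)) ⟩
    (Y′ ℕ.* b ^ l /b^ l ℕ.+ Z /b^ l) % b
      ≡⟨ cong (λ q → (q ℕ.+ Z /b^ l) % b) (m*n/n≡m Y′ (b ^ l) {{b^-nonZero l}}) ⟩
    (Y′ ℕ.+ Z /b^ l) % b
      ≡⟨ %-remove-+ˡ (Z /b^ l) (∣n⇒∣m*n Y (b∣b^ (t ℕ.∸ l) (ℕP.m<n⇒0<n∸m l<t))) ⟩
    (Z /b^ l) % b ∎
    where
    open ≡-Reasoning
    Y′ = Y ℕ.* b ^ (t ℕ.∸ l)
    b∣b^ : ∀ u → 0 ℕ.< u → b ∣ b ^ u
    b∣b^ (suc u) _ = m∣m*n (b ^ u)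

  digit-high : ∀ Y Z {t} l → Z ℕ.< b ^ t → t ℕ.≤ l → digit b (Y ℕ.* b ^ t ℕ.+ Z) l ≡ digit b Y (l ℕ.∸ t)
  digit-high Y Z {t} l Z<b^t t≤l = cong (_% b) (begin
    (Y ℕ.* b ^ t ℕ.+ Z) /b^ l
      ≡⟨ /-congʳ {{b^-nonZero l}} {{nz}} b^l-split ⟩
    ((Y ℕ.* b ^ t ℕ.+ Z) / (b ^ t ℕ.* b ^ (l ℕ.∸ t))) {{nz}}
      ≡⟨ m/n/o≡m/[n*o] _ (b ^ t) (b ^ (l ℕ.∸ t)) {{b^-nonZero t}} {{b^-nonZero (l ℕ.∸ t)}} {{nz}} ⟨
    (Y ℕ.* b ^ t ℕ.+ Z) /b^ t /b^ (l ℕ.∸ t)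
      ≡⟨ cong (_/b^ (l ℕ.∸ t)) shifted ⟩
    Y /b^ (l ℕ.∸ t) ∎)
    where
    open ≡-Reasoning
    nz = ℕP.m*n≢0 (b ^ t) (b ^ (l ℕ.∸ t)) {{b^-nonZero t}} {{b^-nonZero (l ℕ.∸ t)}}
    b^l-split : b ^ l ≡ b ^ t ℕ.* b ^ (l ℕ.∸ t)
    b^l-split = trans (cong (b ^_) (sym (ℕP.m+[n∸m]≡n t≤l))) (ℕP.^-distribˡ-+-* b t (l ℕ.∸ t))
    shifted : (Y ℕ.* b ^ t ℕ.+ Z) /b^ t ≡ Y
    shifted = trans (+-distrib-/-∣ˡ Z {{b^-nonZero t}} (n∣m*n Y))
                    (trans (cong₂ ℕ._+_ (m*n/n≡m Y (b ^ t) {{b^-nonZero t}}) (m<n⇒m/n≡0 {{b^-nonZero t}} Z<b^t))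
                           (ℕP.+-identityʳ Y))

  digit-multiple : ∀ Y {t} l → l ℕ.< t → digit b (Y ℕ.* b ^ t) l ≡ 0
  digit-multiple Y {t} l l<t = begin
    digit b (Y ℕ.* b ^ t) l         ≡⟨ cong (λ R → digit b R l) (ℕP.+-identityʳ (Y ℕ.* b ^ t)) ⟨
    digit b (Y ℕ.* b ^ t ℕ.+ 0) l   ≡⟨ digit-low Y 0 l l<t ⟩
    digit b 0 l                     ≡⟨ digit-zero l ⟩
    0                               ∎
    where open ≡-Reasoning

  AddsWithoutCarry : ℕ → ℕ → Set
  AddsWithoutCarry A C = ∀ l → digit b (A ℕ.+ C) l ≡ digit b A l ℕ.+ digit b C l

  digits-add : ∀ Y Z {t} → Z ℕ.< b ^ t → AddsWithoutCarry (Y ℕ.* b ^ t) Z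
  digits-add Y Z {t} Z<b^t l with l ℕ.<? t
  ... | yes l<t = trans (digit-low Y Z l l<t) (cong (ℕ._+ digit b Z l) (sym (digit-multiple Y l l<t)))
  ... | no  l≮t = begin
    digit b (Y ℕ.* b ^ t ℕ.+ Z) l                  ≡⟨ digit-high Y Z l Z<b^t t≤l ⟩
    digit b Y (l ℕ.∸ t)                            ≡⟨ digit-high Y 0 l (ℕP.m^n>0 b t) t≤l ⟨
    digit b (Y ℕ.* b ^ t ℕ.+ 0) l                  ≡⟨ cong (λ R → digit b R l) (ℕP.+-identityʳ (Y ℕ.* b ^ t)) ⟩
    digit b (Y ℕ.* b ^ t) l                        ≡⟨ ℕP.+-identityʳ _ ⟨
    digit b (Y ℕ.* b ^ t) l ℕ.+ 0                  ≡⟨ cong (digit b (Y ℕ.* b ^ t) l ℕ.+_) (digit-small l Z<b^l) ⟨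
    digit b (Y ℕ.* b ^ t) l ℕ.+ digit b Z l        ∎
    where
    open ≡-Reasoning
    t≤l = ℕP.≮⇒≥ l≮t
    Z<b^l = ℕP.<-≤-trans Z<b^t (ℕP.^-monoʳ-≤ b t≤l)

  lowest-digit : ∀ n s → (∀ l → l ℕ.< s → digit b n l ≡ 0) → digit b n s ≢ 0 →
                 ∃ λ q → n ≡ b ^ s ℕ.+ q ℕ.* b ^ s
  lowest-digit n s low top≢0 = decompose (n /b^ s) refl
    where
    decompose : ∀ q → n /b^ s ≡ q → ∃ λ q′ → n ≡ b ^ s ℕ.+ q′ ℕ.* b ^ s
    decompose zero    n/bˢ≡0 = ⊥-elim (top≢0 (trans (cong (_% b) n/bˢ≡0) (m<n⇒m%n≡m (ℕ.>-nonZero⁻¹ b))))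
    decompose (suc q) n/bˢ≡q = q , trans (sym (low-digits-zero n s low)) (cong (ℕ._* b ^ s) n/bˢ≡q)

  -- bˢ − bᵐ = (b^{s−m} − 1) bᵐ has no digits below m.
  gap-digits : ∀ {s m} → m ℕ.≤ s → ∀ l → l ℕ.< m → digit b (b ^ s ℕ.∸ b ^ m) l ≡ 0
  gap-digits {s} {m} m≤s l l<m = trans (cong (λ R → digit b R l) gap) (digit-multiple (b ^ (s ℕ.∸ m) ℕ.∸ 1) l l<m)
    where
    gap : b ^ s ℕ.∸ b ^ m ≡ (b ^ (s ℕ.∸ m) ℕ.∸ 1) ℕ.* b ^ m
    gap = trans (cong₂ ℕ._∸_ (pow-split m m≤s) (sym (ℕP.*-identityˡ (b ^ m))))
                (sym (ℕP.*-distribʳ-∸ (b ^ m) (b ^ (s ℕ.∸ m)) 1))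

module BinomialSeries (b : ℕ) .{{_ : NonZero b}} (b≥2 : 2 ℕ.≤ b) where

  open Digits b b≥2

  F I J : ℕ → Series
  F l = onePlusX (b ^ l)
  I l = invInX (b ^ l) {{b^-nonZero l}}
  J l = invInY (b ^ l) {{b^-nonZero l}}

  fNegX-0 : fNegX b 0 ≗ oneS
  fNegX-0 = prodS-truncate 0 1 I (digit b 0) z≤n (λ l _ → digit-zero l)

  fNegY-0 : fNegY b 0 ≗ oneS
  fNegY-0 = prodS-truncate 0 1 J (digit b 0) z≤n (λ l _ → digit-zero l)

  fPos-0 : fPos b 0 ≗ oneS
  fPos-0 = prodS-truncate 0 1 F (digit b 0) z≤n (λ l _ → digit-zero l)

  -- Expanding f_{-R,b} in 1/x gives its expansion in x shifted by R = Σ R_l bˡ.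
  fNegY-shift : ∀ R → fNegY b R ≗ shift R (fNegX b R)
  fNegY-shift R = ≗-trans (prodS-cong (suc R) (digit b R) (λ l → invInY-shift (b ^ l) {{b^-nonZero l}}))
                          (≗-trans (prodS-shift (suc R) (b ^_) I (digit b R))
                                   (λ i → cong (λ w → shift w (fNegX b R) i) (weight-digits R)))

  binom-neg-nonneg : ∀ A K → bbinom b (- (+ A)) (+ K) ≡ fNegX b A K
  binom-neg-nonneg zero    K = trans (fPos-0 K) (sym (fNegX-0 K))
  binom-neg-nonneg (suc A) K = refl

  binom-neg-neg : ∀ A K → A ℕ.≤ suc K → bbinom b (- (+ A)) -[1+ K ] ≡ fNegX b A (suc K ℕ.∸ A)
  binom-neg-neg A K A≤1+K =
    trans (fNegY-form A) (trans (fNegY-shift A (suc K)) (shift-≥ A (fNegX b A) (suc K) A≤1+K))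
    where
    fNegY-form : ∀ A → bbinom b (- (+ A)) -[1+ K ] ≡ fNegY b A (suc K)
    fNegY-form zero    = sym (fNegY-0 (suc K))
    fNegY-form (suc A) = refl

  degree-fPos : ∀ C → DegreeAtMost C (fPos b C)
  degree-fPos C = subst (λ D → DegreeAtMost D (fPos b C)) (weight-digits C)
                        (degree-prodS (suc C) (b ^_) F (digit b C) (λ l → degree-onePlusX (b ^ l)))

  palindromic-fPos : ∀ C → Palindromic C (fPos b C)
  palindromic-fPos C = subst (λ D → Palindromic D (fPos b C)) (weight-digits C)
                             (palindromic-prodS (suc C) (b ^_) F (digit b C) (λ l → degree-onePlusX (b ^ l))
                                                (λ l → palindromic-onePlusX (b ^ l)))

  multiples-fPos : ∀ m C → (∀ l → l ℕ.< m → digit b C l ≡ 0) → OnMultiplesOf (b ^ m) (fPos b C)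
  multiples-fPos m C low = multiples-prodS (b ^ m) (suc C) F (digit b C) factor
    where
    factor : ∀ l → l ℕ.< suc C → OnMultiplesOf (b ^ m) (powS (F l) (digit b C l))
    factor l _ with l ℕ.<? m
    ... | yes l<m rewrite low l l<m = multiples-one (b ^ m)
    ... | no  l≮m = multiples-powS (b ^ m) (digit b C l)
                      (multiples-onePlusX (b ^ m) (b ^ l)
                         (subst (b ^ m ∣_) (sym (pow-split m (ℕP.≮⇒≥ l≮m))) (n∣m*n (b ^ (l ℕ.∸ m)))))

  -- If A + C is formed without carries, then f_{C,b} f_{-(A+C),b} = f_{-A,b} as series in x:
  -- the factors of f_{-(A+C)} coming from the digits of C cancel those of f_C.
  fPos-⊛-fNegX : ∀ A C → AddsWithoutCarry A C →
                 fPos b C ⊛ fNegX b (A ℕ.+ C) ≗ fNegX b A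
  fPos-⊛-fNegX A C no-carry = begin
    fPos b C ⊛ fNegX b (A ℕ.+ C)
      ≈⟨ ⊛-cong (≗-sym (prodS-truncate (suc C) L F (digit b C) C<L (λ l → digit-beyond l)))
                (prodS-cong-exp L I no-carry) ⟩
    ΠF C ⊛ prodS L I (λ l → digit b A l ℕ.+ digit b C l)
      ≈⟨ ⊛-congʳ (ΠF C) (prodS-+ L I (digit b A) (digit b C)) ⟩
    ΠF C ⊛ (ΠI A ⊛ ΠI C)
      ≈⟨ x∙yz≈y∙xz (ΠF C) (ΠI A) (ΠI C) ⟩
    ΠI A ⊛ (ΠF C ⊛ ΠI C)
      ≈⟨ ⊛-congʳ (ΠI A) (prodS-⊛ L F I (digit b C)) ⟩
    ΠI A ⊛ prodS L (λ l → F l ⊛ I l) (digit b C)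
      ≈⟨ ⊛-congʳ (ΠI A) (prodS-ones L _ (digit b C) (λ l → invInX-inverse (b ^ l) {{b^-nonZero l}})) ⟩
    ΠI A ⊛ oneS
      ≈⟨ ⊛-identityʳ (ΠI A) ⟩
    ΠI A
      ≈⟨ prodS-truncate (suc A) L I (digit b A) A<L (λ l → digit-beyond l) ⟩
    fNegX b A ∎
    where
    open ≗-Reasoning
    L = suc (A ℕ.+ C)
    ΠF ΠI : ℕ → Series
    ΠF R = prodS L F (digit b R)
    ΠI R = prodS L I (digit b R)
    C<L = s≤s (ℕP.m≤n+m C A)
    A<L = s≤s (ℕP.m≤m+n A C)

  fPos-beyond : ∀ C j z → C ℕ.< j → fPos b C j * z ≡ +0
  fPos-beyond C j z C<j = trans (cong (_* z) (degree-fPos C j C<j)) (ℤP.*-zeroˡ z)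

  expansion-nonneg : ∀ A C N → AddsWithoutCarry A C →
                     C ℕ.≤ N → ∀ K → N ℕ.≤ K →
                     bbinom b (- (+ A)) (+ K)
                       ≡ sumTo N (λ j → fPos b C j * bbinom b (- (+ (A ℕ.+ C))) (+ K - + j))
  expansion-nonneg A C N no-carry C≤N K N≤K = begin
    bbinom b (- (+ A)) (+ K)
      ≡⟨ binom-neg-nonneg A K ⟩
    fNegX b A K
      ≡⟨ fPos-⊛-fNegX A C no-carry K ⟨
    (fPos b C ⊛ G) K
      ≡⟨ sum-shrink N K N≤K (λ j N<j _ → fPos-beyond C j _ (ℕP.≤-<-trans C≤N N<j)) ⟩
    sumTo N (λ j → fPos b C j * G (K ℕ.∸ j))
      ≡⟨ sum-cong≤ N (λ j j≤N → cong (fPos b C j *_) (term j (ℕP.≤-trans j≤N N≤K))) ⟨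
    sumTo N (λ j → fPos b C j * bbinom b (- (+ (A ℕ.+ C))) (+ K - + j)) ∎
    where
    open ≡-Reasoning
    G = fNegX b (A ℕ.+ C)
    term : ∀ j → j ℕ.≤ K → bbinom b (- (+ (A ℕ.+ C))) (+ K - + j) ≡ G (K ℕ.∸ j)
    term j j≤K = trans (cong (bbinom b (- (+ (A ℕ.+ C)))) (trans (ℤP.[+m]-[+n]≡m⊖n K j) (ℤP.⊖-≥ j≤K)))
                       (binom-neg-nonneg (A ℕ.+ C) (K ℕ.∸ j))

  -- For k = −(K+1) ≤ −(A+C), both sides are coefficients of expansions in 1/x; the palindromic
  -- symmetry of f_C turns the coefficient of x^{T+C} in f_C f_{-(A+C)}, T = K + 1 − (A + C),
  -- into the required sum.
  expansion-neg : ∀ A C N → AddsWithoutCarry A C →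
                  C ℕ.≤ N → ∀ K → A ℕ.+ C ℕ.≤ suc K →
                  bbinom b (- (+ A)) -[1+ K ]
                    ≡ sumTo N (λ j → fPos b C j * bbinom b (- (+ (A ℕ.+ C))) (-[1+ K ] - + j))
  expansion-neg A C N no-carry C≤N K B≤1+K = begin
    bbinom b (- (+ A)) -[1+ K ]
      ≡⟨ binom-neg-neg A K (ℕP.≤-trans (ℕP.m≤m+n A C) B≤1+K) ⟩
    fNegX b A (suc K ℕ.∸ A)
      ≡⟨ cong (fNegX b A) 1+K∸A≡T+C ⟩
    fNegX b A (T ℕ.+ C)
      ≡⟨ fPos-⊛-fNegX A C no-carry (T ℕ.+ C) ⟨
    (fPos b C ⊛ G) (T ℕ.+ C)
      ≡⟨ sum-shrink C (T ℕ.+ C) (ℕP.m≤n+m C T) (λ i C<i _ → fPos-beyond C i _ C<i) ⟩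
    sumTo C (λ i → fPos b C i * G (T ℕ.+ C ℕ.∸ i))
      ≡⟨ sum-reverse C _ ⟩
    sumTo C (λ j → fPos b C (C ℕ.∸ j) * G (T ℕ.+ C ℕ.∸ (C ℕ.∸ j)))
      ≡⟨ sum-cong≤ C reflect ⟩
    sumTo C (λ j → fPos b C j * G (T ℕ.+ j))
      ≡⟨ sum-shrink C N C≤N (λ j C<j _ → fPos-beyond C j _ C<j) ⟨
    sumTo N (λ j → fPos b C j * G (T ℕ.+ j))
      ≡⟨ sum-cong N (λ j → cong (fPos b C j *_) (term j)) ⟨
    sumTo N (λ j → fPos b C j * bbinom b (- (+ B)) (-[1+ K ] - + j)) ∎
    where
    open ≡-Reasoning
    B = A ℕ.+ C
    G = fNegX b B
    T = suc K ℕ.∸ B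
    1+K∸A≡T+C : suc K ℕ.∸ A ≡ T ℕ.+ C
    1+K∸A≡T+C = sym (trans (cong (ℕ._+ C) (sym (ℕP.∸-+-assoc (suc K) A C)))
                           (ℕP.m∸n+n≡m (ℕP.m+n≤o⇒m≤o∸n C (subst (ℕ._≤ suc K) (ℕP.+-comm A C) B≤1+K))))
    reflect : ∀ j → j ℕ.≤ C → fPos b C (C ℕ.∸ j) * G (T ℕ.+ C ℕ.∸ (C ℕ.∸ j)) ≡ fPos b C j * G (T ℕ.+ j)
    reflect j j≤C = cong₂ _*_ (palindromic-fPos C j j≤C)
                              (cong G (trans (ℕP.+-∸-assoc T (ℕP.m∸n≤m C j)) (cong (T ℕ.+_) (ℕP.m∸[m∸n]≡n j≤C))))
    term : ∀ j → bbinom b (- (+ B)) (-[1+ K ] - + j) ≡ G (T ℕ.+ j)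
    term j = begin
      bbinom b (- (+ B)) (-[1+ K ] - + j)
        ≡⟨ cong (bbinom b (- (+ B))) (trans (ℤP.neg-minus-pos K j) (cong -[1+_] (ℕP.+-comm j K))) ⟩
      bbinom b (- (+ B)) -[1+ K ℕ.+ j ]
        ≡⟨ binom-neg-neg B (K ℕ.+ j) (ℕP.≤-trans B≤1+K (ℕP.m≤m+n (suc K) j)) ⟩
      G (suc K ℕ.+ j ℕ.∸ B)
        ≡⟨ cong G (ℕP.+-∸-comm j B≤1+K) ⟩
      G (T ℕ.+ j) ∎

  expansion : ∀ m A C N → AddsWithoutCarry A C →
              (∀ l → l ℕ.< m → digit b C l ≡ 0) → 1 ℕ.≤ A ℕ.+ C → C ℕ.≤ N →
              ∀ k → (+ N ℤ.≤ k ⊎ k ℤ.≤ - (+ (A ℕ.+ C))) →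
              bbinom b (- (+ A)) k
                ≡ sumTo N (λ j → ind ⌊ b ^ m ∣? j ⌋ (bbinom b (+ C) (+ j) * bbinom b (- (+ (A ℕ.+ C))) (k - + j)))
  expansion m A C N no-carry low 1≤B C≤N k k-range =
    trans (by-range k k-range)
          (sym (sum-cong N (λ j → ind-multiples (b ^ m) (fPos b C) (multiples-fPos m C low) j _)))
    where
    by-range : ∀ k → (+ N ℤ.≤ k ⊎ k ℤ.≤ - (+ (A ℕ.+ C))) →
               bbinom b (- (+ A)) k ≡ sumTo N (λ j → fPos b C j * bbinom b (- (+ (A ℕ.+ C))) (k - + j))
    by-range (+ K)    (inj₁ (+≤+ N≤K)) = expansion-nonneg A C N no-carry C≤N K N≤K
    by-range (+ K)    (inj₂ K≤-B)      = ⊥-elim (nonneg-≰-neg 1≤B K≤-B)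
    by-range -[1+ K ] (inj₂ k≤-B)      = expansion-neg A C N no-carry C≤N K (neg-≤-neg 1≤B k≤-B)

proposition3p2 : (b : ℕ) .{{_ : NonZero b}} → 2 ℕ.≤ b →
    (n s : ℕ) → 0 ℕ.< n → 1 ℕ.≤ s →
    ((l : ℕ) → l ℕ.< s → digit b n l ≡ 0) → digit b n s ≢ 0 →
    (m : ℕ) → m ℕ.< s → (k : ℤ) →
    (+ (b ^ s) ℤ.≤ k ⊎ k ℤ.≤ - (+ n) + + (b ^ m)) →
    bbinom b (- (+ n) + + (b ^ s)) k
      ≡ sumTo (b ^ s) (λ j → ind ⌊ b ^ m ∣? j ⌋
          (bbinom b (+ (b ^ s) - + (b ^ m)) (+ j) ℤ.* bbinom b (- (+ n) + + (b ^ m)) (k - + j)))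
proposition3p2 b b≥2 n s _ _ low top≢0 m m<s k k-range with Digits.lowest-digit b b≥2 n s low top≢0
... | q , n≡bˢ+A = begin
  bbinom b (- (+ n) + + (b ^ s)) k
    ≡⟨ cong (λ r → bbinom b r k) (−n+N≡−A n≡bˢ+A) ⟩
  bbinom b (- (+ A)) k
    ≡⟨ BinomialSeries.expansion b b≥2 m A C (b ^ s) no-carry (gap-digits (ℕP.<⇒≤ m<s)) 1≤A+C
                                (ℕP.m∸n≤m (b ^ s) (b ^ m)) k (map₂ (subst (k ℤ.≤_) −n+bᵐ≡−[A+C]) k-range) ⟩
  rhs (+ C) (- (+ (A ℕ.+ C)))
    ≡⟨ cong₂ rhs (N−P≡C {C = C} {b ^ m} bˢ≡C+bᵐ) −n+bᵐ≡−[A+C] ⟨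
  rhs (+ (b ^ s) - + (b ^ m)) (- (+ n) + + (b ^ m)) ∎
  where
  open ≡-Reasoning
  open Digits b b≥2
  rhs : ℤ → ℤ → ℤ
  rhs r r′ = sumTo (b ^ s) (λ j → ind ⌊ b ^ m ∣? j ⌋ (bbinom b r (+ j) ℤ.* bbinom b r′ (k - + j)))
  A = q ℕ.* b ^ s
  C = b ^ s ℕ.∸ b ^ m
  bᵐ<bˢ : b ^ m ℕ.< b ^ s
  bᵐ<bˢ = ℕP.^-monoʳ-< b b≥2 m<s
  bˢ≡C+bᵐ : b ^ s ≡ C ℕ.+ b ^ m
  bˢ≡C+bᵐ = sym (ℕP.m∸n+n≡m (ℕP.<⇒≤ bᵐ<bˢ))
  −n+bᵐ≡−[A+C] : - (+ n) + + (b ^ m) ≡ - (+ (A ℕ.+ C))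
  −n+bᵐ≡−[A+C] = −n+P≡−[A+C] {A = A} {C} {b ^ m} n≡bˢ+A bˢ≡C+bᵐ
  1≤A+C : 1 ℕ.≤ A ℕ.+ C
  1≤A+C = ℕP.≤-trans (ℕP.m<n⇒0<n∸m bᵐ<bˢ) (ℕP.m≤n+m C A)
  no-carry : AddsWithoutCarry A C
  no-carry = digits-add q C {s} (ℕP.∸-monoʳ-< (ℕP.m^n>0 b m) (ℕP.<⇒≤ bᵐ<bˢ))
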